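{- For a connected finite simple graph $G$, the following are equivalent: (a) there exists $v\in V(G)$ that has the neighbor-swapping property; (b) every $v\in V(G)$ has the neighbor-swapping property; (c) $G$ is edge-flip-invariant. Moreover, in this case $G$ is vertex-transitive.
   Context: A vertex $v$ has the neighbor-swapping property if for every neighbor $u$ of $v$ there is an automorphism $\phi$ of $G$ with $\phi(v)=u$ and $\phi(u)=v$. $G$ is edge-flip-invariant if for every edge $\{u,v\}$ there is an automorphism $\phi$ with $\phi(u)=v$ and $\phi(v)=u$. $G$ is vertex-transitive if for all $u,v\in V(G)$ some automorphism maps $u$ to $v$. -}

module Defs where

open import Data.Nat using (ℕ; suc)
open import Data.Fin using (Fin)
open import Data.Bool using (Bool; true; false)
open import Data.List using (List; []; _∷_)
open import Data.Product using (Σ; ∃; _×_; _,_)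
open import Relation.Binary.PropositionalEquality using (_≡_)
open import Function.Bundles using (_⇔_)

record Graph (n : ℕ) : Set where
  field
    adj   : Fin n → Fin n → Bool
    sym   : ∀ u v → adj u v ≡ adj v u
    irrefl : ∀ v → adj v v ≡ false

open Graph public

Adj : ∀ {n} → Graph n → Fin n → Fin n → Set
Adj G u v = adj G u v ≡ true

data Walk {n : ℕ} (G : Graph n) : Fin n → Fin n → Set where
  here : ∀ {v} → Walk G v v
  step : ∀ {u w v} → Adj G u w → Walk G w v → Walk G u v

Connected : ∀ {n} → Graph n → Set
Connected G = ∀ u v → Walk G u v

record Automorphism {n : ℕ} (G : Graph n) : Set where
  field
    to      : Fin n → Fin n
    from    : Fin n → Fin n
    to-from : ∀ v → to (from v) ≡ v
    from-to : ∀ v → from (to v) ≡ v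
    preserves : ∀ u v → adj G (to u) (to v) ≡ adj G u v

open Automorphism public

NeighborSwapping : ∀ {n} → Graph n → Fin n → Set
NeighborSwapping G v =
  ∀ u → Adj G v u → Σ (Automorphism G) λ φ → (to φ v ≡ u) × (to φ u ≡ v)

EdgeFlipInvariant : ∀ {n} → Graph n → Set
EdgeFlipInvariant G =
  ∀ u v → Adj G u v → Σ (Automorphism G) λ φ → (to φ u ≡ v) × (to φ v ≡ u)

VertexTransitive : ∀ {n} → Graph n → Set
VertexTransitive G = ∀ u v → Σ (Automorphism G) λ φ → to φ u ≡ v

-- Neighbor-swapping is invariant under automorphisms: conjugating the swap of
-- v and u by φ swaps φ v and φ u. If σ swaps v with its neighbor u then u = σ v,
-- so the property passes from a vertex to each of its neighbors, and by
-- connectedness to every vertex. Composing the swaps along a walk from u to v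
-- gives an automorphism mapping u to v.
module Submission where

open import Defs
open import Data.Nat using (ℕ; suc)
open import Data.Fin using (zero)
open import Data.Bool using (true)
open import Data.Product using (∃; _×_; _,_; Σ)
open import Function.Bundles using (_⇔_; mk⇔)
open import Relation.Binary.PropositionalEquality
  using (_≡_; refl; trans; cong; cong₂; subst; module ≡-Reasoning)
  renaming (sym to ≡-sym)

module _ {n : ℕ} {G : Graph n} where

  idᵃ : Automorphism G
  idᵃ = record
    { to = λ x → x ; from = λ x → x
    ; to-from = λ _ → refl ; from-to = λ _ → refl ; preserves = λ _ _ → refl }

  infixr 9 _∘ᵃ_
  _∘ᵃ_ : Automorphism G → Automorphism G → Automorphism G
  ψ ∘ᵃ σ = record
    { to = λ x → to ψ (to σ x)
    ; from = λ x → from σ (from ψ x)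
    ; to-from = λ x → trans (cong (to ψ) (to-from σ (from ψ x))) (to-from ψ x)
    ; from-to = λ x → trans (cong (from σ) (from-to ψ (to σ x))) (from-to σ x)
    ; preserves = λ u v → trans (preserves ψ (to σ u) (to σ v)) (preserves σ u v)
    }

  _⁻¹ᵃ : Automorphism G → Automorphism G
  σ ⁻¹ᵃ = record
    { to = from σ
    ; from = to σ
    ; to-from = from-to σ
    ; from-to = to-from σ
    ; preserves = λ u v → trans (≡-sym (preserves σ (from σ u) (from σ v)))
                                 (cong₂ (adj G) (to-from σ u) (to-from σ v))
    }

  NeighborSwapping-transport : ∀ {v} (φ : Automorphism G) →
    NeighborSwapping G v → NeighborSwapping G (to φ v)
  NeighborSwapping-transport {v} φ ns u φv~u with ns (from φ u) v~φ⁻¹u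
    where
    open ≡-Reasoning
    v~φ⁻¹u : Adj G v (from φ u)
    v~φ⁻¹u = begin
      adj G v (from φ u)                   ≡⟨ cong (λ x → adj G x (from φ u)) (≡-sym (from-to φ v)) ⟩
      adj G (from φ (to φ v)) (from φ u)   ≡⟨ preserves (φ ⁻¹ᵃ) (to φ v) u ⟩
      adj G (to φ v) u                     ≡⟨ φv~u ⟩
      true                                 ∎
  ... | τ , τv , τu = φ ∘ᵃ τ ∘ᵃ φ ⁻¹ᵃ , swaps-φv , swaps-u
    where
    open ≡-Reasoning
    swaps-φv : to φ (to τ (from φ (to φ v))) ≡ u
    swaps-φv = begin
      to φ (to τ (from φ (to φ v)))   ≡⟨ cong (λ x → to φ (to τ x)) (from-to φ v) ⟩
      to φ (to τ v)                   ≡⟨ cong (to φ) τv ⟩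
      to φ (from φ u)                 ≡⟨ to-from φ u ⟩
      u                               ∎
    swaps-u : to φ (to τ (from φ u)) ≡ to φ v
    swaps-u = cong (to φ) τu

  NeighborSwapping-adj : ∀ {v u} → NeighborSwapping G v → Adj G v u →
    NeighborSwapping G u
  NeighborSwapping-adj ns v~u with ns _ v~u
  ... | σ , σv≡u , _ = subst (NeighborSwapping G) σv≡u (NeighborSwapping-transport σ ns)

  NeighborSwapping-walk : ∀ {v w} → Walk G v w → NeighborSwapping G v →
    NeighborSwapping G w
  NeighborSwapping-walk here ns = ns
  NeighborSwapping-walk (step v~u p) ns =
    NeighborSwapping-walk p (NeighborSwapping-adj ns v~u)

  walk-automorphism : (∀ {u w} → Adj G u w → Σ (Automorphism G) λ φ → to φ u ≡ w) →
    ∀ {u v} → Walk G u v → Σ (Automorphism G) λ φ → to φ u ≡ v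
  walk-automorphism moves here = idᵃ , refl
  walk-automorphism moves (step u~w p) with moves u~w | walk-automorphism moves p
  ... | σ , σu≡w | ψ , ψw≡v = ψ ∘ᵃ σ , trans (cong (to ψ) σu≡w) ψw≡v

theorem6 : (n : ℕ) (G : Graph (suc n)) → Connected G →
    ((∃ λ v → NeighborSwapping G v) ⇔ (∀ v → NeighborSwapping G v))
    × ((∀ v → NeighborSwapping G v) ⇔ EdgeFlipInvariant G)
    × ((∃ λ v → NeighborSwapping G v) → VertexTransitive G)
theorem6 n G conn =
    mk⇔ everywhere (λ ns → zero , ns zero)
  , mk⇔ (λ ns → ns) (λ flip → flip)
  , λ ex u v → walk-automorphism (moves (everywhere ex)) (conn u v)
  where
  everywhere : (∃ λ v → NeighborSwapping G v) → ∀ v → NeighborSwapping G v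
  everywhere (v , ns) w = NeighborSwapping-walk (conn v w) ns

  moves : (∀ v → NeighborSwapping G v) →
    ∀ {u w} → Adj G u w → Σ (Automorphism G) λ φ → to φ u ≡ w
  moves ns u~w with ns _ _ u~w
  ... | φ , φu≡w , _ = φ , φu≡w
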